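{- Let $G$ be a $1$-almost tree with fire source $r$ that lies on a cycle $C = (r, u_1, \dots, u_p)$ of $G$ (cyclic order), and suppose every vertex $v \in N(r) \cup \{u_1,\dots,u_p\}$ satisfies $w(v) < \sqrt{w(C)}$. Let $\hat u \in \{u_1, u_p\}$ be a vertex with $\mathrm{tol}(\hat u, C, \sqrt{w(C)}) = \max\{\mathrm{tol}(u_1, C, \sqrt{w(C)}), \mathrm{tol}(u_p, C, \sqrt{w(C)})\}$. Then for every $h \in \{1,\dots,p\}$ and every $d \in \mathbb{N}$, $$\frac{\mathrm{count}(T(C\setminus u_h), d)}{\mathrm{count}(T(C\setminus \hat u), d) + 1} \le 2\sqrt{w(C)}.$$
   Context: A $1$-almost tree is a connected graph containing at most one simple cycle. $N(r)$ is the set of neighbours of $r$. For $S \subseteq V(G)\setminus\{r\}$, the covered set $\kappa(S)$ is the set of vertices $u$ such that every path from $u$ to $r$ contains a vertex of $S$; $w(S) = |\kappa(S)|$, $\kappa(v)=\kappa(\{v\})$, $w(v) = w(\{v\})$; for the cycle $C$ through $r$, $\kappa(C) = \kappa(\{u_1,\dots,u_p\})$ and $w(C) = |\kappa(C)|$. For $u \in \{u_1,\dots,u_p\}$, $T(C\setminus u)$ is the subgraph of $G$ induced by $(\{r\}\cup\kappa(C))\setminus\kappa(u)$. For a graph $H$ containing $r$ and $d\in\mathbb{N}$, $\mathrm{count}(H,d) = |\{v\in V(H) : \mathrm{dist}_H(r,v)\ge d\}|$. The tolerance is $\mathrm{tol}(u, C, m) = \max\{d \in \mathbb{N} : \mathrm{count}(T(C\setminus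 u), d) \ge m\}$. (In the paper's algorithm, $\hat u$ is the vertex protected by the Break-cycle step, which is executed exactly in the situation described by the hypotheses.) -}

module Defs where

open import Data.Nat using (ℕ; suc; _≤_; _∸_; _<_; _*_; _+_; _⊔_)
open import Data.Fin using (Fin)
open import Data.Bool using (Bool; true; false)
open import Data.List using (List; []; _∷_; _++_; [_]; length; head; last; zip; drop)
open import Data.List.Membership.Propositional using (_∈_)
open import Data.List.Relation.Unary.All using (All)
open import Data.List.Relation.Unary.Any using (Any)
open import Data.List.Relation.Unary.Linked using (Linked)
open import Data.List.Relation.Unary.Unique.Propositional using (Unique)
open import Data.Maybe using (Maybe; just)
open import Data.Product using (Σ; ∃; _×_; _,_)
open import Data.Sum using (_⊎_)
open import Relation.Binary.PropositionalEquality using (_≡_)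
open import Relation.Nullary using (¬_)

record Graph (n : ℕ) : Set where
  field
    adj   : Fin n → Fin n → Bool
    sym   : ∀ x y → adj x y ≡ adj y x
    irrefl : ∀ x → adj x x ≡ false

module _ {n : ℕ} (G : Graph n) where
  open Graph G

  Adj : Fin n → Fin n → Set
  Adj x y = adj x y ≡ true

  WalkIn : (Fin n → Set) → List (Fin n) → Set
  WalkIn P xs = All P xs × Linked Adj xs

  Path : Fin n → Fin n → List (Fin n) → Set
  Path u v xs = Unique xs × Linked Adj xs × head xs ≡ just u × last xs ≡ just v

  Connected : Set
  Connected = ∀ u v → ∃ λ xs → Path u v xs

  SimpleCycle : List (Fin n) → Set
  SimpleCycle cs = 3 ≤ length cs × Unique cs × Linked Adj cs
                   × (∀ a b → head cs ≡ just a → last cs ≡ just b → Adj b a)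

  closeCycle : List (Fin n) → List (Fin n)
  closeCycle [] = []
  closeCycle (c ∷ cs) = c ∷ cs ++ [ c ]

  consecPairs : List (Fin n) → List (Fin n × Fin n)
  consecPairs xs = zip xs (drop 1 xs)

  CycEdge : List (Fin n) → Fin n → Fin n → Set
  CycEdge cs x y = ((x , y) ∈ consecPairs (closeCycle cs)) ⊎ ((y , x) ∈ consecPairs (closeCycle cs))

  AtMostOneCycle : Set
  AtMostOneCycle = ∀ cs ds → SimpleCycle cs → SimpleCycle ds →
                   ∀ x y → (CycEdge cs x y → CycEdge ds x y) × (CycEdge ds x y → CycEdge cs x y)

  AlmostTree1 : Set
  AlmostTree1 = Connected × AtMostOneCycle

  Covered : Fin n → (Fin n → Set) → Fin n → Set
  Covered r S u = ∀ xs → Path u r xs → Any S xs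

  -- dist_H(r,v) ≥ d, H the subgraph induced by P (unreachable: distance ∞)
  DistAtLeast : (Fin n → Set) → Fin n → Fin n → ℕ → Set
  DistAtLeast P r v d = ∀ xs → WalkIn P xs → head xs ≡ just r → last xs ≡ just v → d ≤ length xs ∸ 1

  -- vertex set of T(C \ u), C = (r, us)
  InT : Fin n → List (Fin n) → Fin n → Fin n → Set
  InT r us u x = (x ≡ r ⊎ Covered r (_∈ us) x) × ¬ Covered r (_≡ u) x

Card : {n : ℕ} → (Fin n → Set) → ℕ → Set
Card {n} P k = Σ (List (Fin n)) λ xs → Unique xs × (∀ x → (x ∈ xs → P x) × (P x → x ∈ xs)) × length xs ≡ k

module _ {n : ℕ} (G : Graph n) where
  CountT : Fin n → List (Fin n) → Fin n → ℕ → ℕ → Set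
  CountT r us u d c = Card (λ v → InT G r us u v × DistAtLeast G (InT G r us u) r v d) c

  -- tol(u, C, √W) = t, where count ≥ √W is rendered as W ≤ count²
  IsTol : Fin n → List (Fin n) → Fin n → ℕ → ℕ → Set
  IsTol r us u W t = (∃ λ c → CountT r us u t c × W ≤ c * c)
                   × (∀ d c → CountT r us u d c → W ≤ c * c → d ≤ t)

module Submission where

-- Let S(u) be the set of vertices of T(C ∖ u) at distance at least d from r, so that
-- count(T(C ∖ u), d) = |S(u)|.  If d ≤ tol(û), then |S(û)| ≥ √w(C), while
-- |S(uₕ)| ≤ |{r} ∪ κ(C)| ≤ 2 w(C).  If d > tol(û) = max(tol(u₁), tol(uₚ)), then
-- |S(u₁)| and |S(uₚ)| are both below √w(C), and S(uₕ) ⊆ S(u₁) ∪ S(uₚ): a vertex x of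
-- S(uₕ) has a path Q to r avoiding uₕ, which enters r through at most one of u₁, uₚ.
-- For the other one, b, uniqueness of the cycle forces Q to avoid b and every r–x path
-- inside T(C ∖ b) to avoid uₕ, as otherwise one could close a cycle missing uₕ or b.
-- Hence x ∈ T(C ∖ b), and distances from r to x in T(C ∖ b) are at least those in T(C ∖ uₕ).

open import Defs
open import Data.Empty using (⊥; ⊥-elim)
open import Data.Bool using (true)
import Data.Bool as Bool
open import Data.Fin using (Fin; zero; suc; _≟_)
open import Data.List using (List; []; _∷_; _++_; [_]; length; head; last; _∷ʳ_; allFin; filter; zip)
open import Data.List.Properties using (length-++; ++-assoc; ∷ʳ-injective; length-tabulate)
open import Data.List.Membership.Propositional using (_∈_; _∉_)
open import Data.List.Membership.Propositional.Properties
  using (∈-∃++; ∈-++⁺ˡ; ∈-++⁺ʳ; ∈-++⁻; ∈-allFin; ∈-filter⁺; ∈-filter⁻)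
open import Data.List.Relation.Binary.Subset.Propositional using (_⊆_)
open import Data.List.Relation.Unary.All as All using (All; []; _∷_; all?)
open import Data.List.Relation.Unary.AllPairs using ([]; _∷_)
open import Data.List.Relation.Unary.Any as Any using (Any; here; there; any?)
open import Data.List.Relation.Unary.Linked using (Linked; []; [-]; _∷_; linked?)
open import Data.List.Relation.Unary.Unique.Propositional using (Unique)
open import Data.List.Relation.Unary.Unique.Propositional.Properties using (allFin⁺; filter⁺)
open import Data.List.Relation.Unary.Unique.DecPropositional using (unique?)
open import Data.Maybe using (just)
open import Data.Maybe.Properties using (just-injective; ≡-dec)
open import Data.Nat using (ℕ; zero; suc; _≤_; _<_; z≤n; s≤s; _+_; _*_; _⊔_; _≤?_)
open import Data.Nat.Properties
  using (≤-refl; ≤-trans; <⇒≤; ≰⇒>; ≤-<-trans; <-irrefl; m≤n⇒m≤1+n; m≤n+m; n≤1+n; +-suc;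
         +-monoˡ-≤; +-mono-≤; *-mono-≤; *-monoʳ-≤; *-assoc; *-identityʳ; ∸-monoˡ-≤;
         m≤m⊔n; m≤n⊔m; ⊔-sel; module ≤-Reasoning)
open import Data.Nat.Solver using (module +-*-Solver)
open import Data.Product using (∃; _×_; _,_; proj₁; proj₂)
open import Data.Sum using (_⊎_; inj₁; inj₂; [_,_]′)
open import Function using (_∘_; id)
open import Relation.Binary.Definitions using (DecidableEquality)
open import Relation.Binary.PropositionalEquality using (_≡_; _≢_; refl; sym; trans; cong; subst)
open import Relation.Nullary using (¬_; Dec; yes; no)
open import Relation.Nullary.Decidable using (_×-dec_; _⊎-dec_; _→-dec_; ¬?)

module _ {A : Set} where

  head-∈ : ∀ {xs : List A} {a} → head xs ≡ just a → a ∈ xs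
  head-∈ {_ ∷ _} refl = here refl

  last-∈ : ∀ {xs : List A} {a} → last xs ≡ just a → a ∈ xs
  last-∈ {_ ∷ []} refl = here refl
  last-∈ {_ ∷ y ∷ ys} l = there (last-∈ {y ∷ ys} l)

  last-∷ : ∀ x (xs : List A) {a} → last xs ≡ just a → last (x ∷ xs) ≡ just a
  last-∷ x (_ ∷ _) l = l

  linked-∷-head : ∀ {R : A → A → Set} {x a} xs → Linked R (x ∷ xs) → head xs ≡ just a → R x a
  linked-∷-head (_ ∷ _) (Rxa ∷ _) refl = Rxa

  ∈-++-++⁻ : ∀ (xs ys : List A) {zs v} → v ∈ (xs ++ ys) ++ zs → v ∈ xs ⊎ v ∈ ys ⊎ v ∈ zs
  ∈-++-++⁻ xs ys {zs} v∈ with ∈-++⁻ (xs ++ ys) v∈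
  ... | inj₂ v∈zs = inj₂ (inj₂ v∈zs)
  ... | inj₁ v∈xs++ys with ∈-++⁻ xs v∈xs++ys
  ...   | inj₁ v∈xs = inj₁ v∈xs
  ...   | inj₂ v∈ys = inj₂ (inj₁ v∈ys)

  penultimate-injective : ∀ (xs ys : List A) {a c z} → xs ++ a ∷ z ∷ [] ≡ ys ++ c ∷ z ∷ [] → a ≡ c
  penultimate-injective xs ys {a} {c} {z} eq =
    proj₂ (∷ʳ-injective xs ys (proj₁ (∷ʳ-injective (xs ∷ʳ a) (ys ∷ʳ c) eq′)))
    where
    eq′ : (xs ∷ʳ a) ∷ʳ z ≡ (ys ∷ʳ c) ∷ʳ z
    eq′ = trans (++-assoc xs [ a ] [ z ]) (trans eq (sym (++-assoc ys [ c ] [ z ])))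

  unique-head : ∀ {a} {xs : List A} → Unique (a ∷ xs) → a ∉ xs
  unique-head (a∉xs ∷ _) a∈xs = All.lookup a∉xs a∈xs refl

  unique-++⁻ʳ : ∀ (xs : List A) {ys} → Unique (xs ++ ys) → Unique ys
  unique-++⁻ʳ [] u = u
  unique-++⁻ʳ (_ ∷ xs) (_ ∷ u) = unique-++⁻ʳ xs u

  unique-++-disjoint : ∀ (xs : List A) {ys a c} → Unique (xs ++ ys) → a ∈ xs → c ∈ ys → a ≢ c
  unique-++-disjoint (_ ∷ xs) (x∉ ∷ _) (here refl) c∈ys = All.lookup x∉ (∈-++⁺ʳ xs c∈ys)
  unique-++-disjoint (_ ∷ xs) (_ ∷ u) (there a∈xs) c∈ys = unique-++-disjoint xs u a∈xs c∈ys

  unique-head≢last : ∀ {xs : List A} {a c} → Unique xs → 2 ≤ length xs →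
                     head xs ≡ just a → last xs ≡ just c → a ≢ c
  unique-head≢last {_ ∷ y ∷ ys} (a∉ ∷ _) _ refl l = All.lookup a∉ (last-∈ {y ∷ ys} l)
  unique-head≢last {_ ∷ []} _ (s≤s ())

  unique-⊆⇒length-≤ : ∀ {xs ys : List A} → Unique xs → xs ⊆ ys → length xs ≤ length ys
  unique-⊆⇒length-≤ {[]} _ _ = z≤n
  unique-⊆⇒length-≤ {x ∷ xs} (x∉xs ∷ u) xs⊆ys with ∈-∃++ (xs⊆ys (here refl))
  ... | pre , post , refl = begin
      suc (length xs)                ≤⟨ s≤s (unique-⊆⇒length-≤ u xs⊆pre++post) ⟩
      suc (length (pre ++ post))     ≡⟨ cong suc (length-++ pre) ⟩
      suc (length pre + length post) ≡⟨ sym (+-suc (length pre) (length post)) ⟩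
      length pre + suc (length post) ≡⟨ sym (length-++ pre) ⟩
      length (pre ++ x ∷ post)       ∎
    where
    open ≤-Reasoning
    xs⊆pre++post : xs ⊆ pre ++ post
    xs⊆pre++post z∈xs with ∈-++⁻ pre (xs⊆ys (there z∈xs))
    ... | inj₁ z∈pre = ∈-++⁺ˡ z∈pre
    ... | inj₂ (here refl) = ⊥-elim (All.lookup x∉xs z∈xs refl)
    ... | inj₂ (there z∈post) = ∈-++⁺ʳ pre z∈post

  Walk : (A → A → Set) → A → A → List A → Set
  Walk R a b xs = Linked R xs × head xs ≡ just a × last xs ≡ just b

  module _ {R : A → A → Set} where

    walk-uncons : ∀ {a b c cs} → Walk R a b (a ∷ c ∷ cs) → R a c × Walk R c b (c ∷ cs)
    walk-uncons (Rac ∷ lk , _ , l) = Rac , lk , refl , l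

    walk-++ : ∀ {a v b} xs ys → Walk R a v xs → Walk R v b (v ∷ ys) → Walk R a b (xs ++ ys)
    walk-++ (_ ∷ []) ys ([-] , refl , refl) w = w
    walk-++ (x ∷ y ∷ xs) ys (Rxy ∷ lk , h , l) w with walk-++ (y ∷ xs) ys (lk , refl , l) w
    ... | lk′ , _ , l′ = Rxy ∷ lk′ , h , l′

    walk-++⁻ˡ : ∀ x xs {a b y ys} → Walk R a b (x ∷ xs ++ y ∷ ys) → ∃ λ v → Walk R a v (x ∷ xs) × R v y
    walk-++⁻ˡ x [] (Rxy ∷ _ , h , _) = x , ([-] , h , refl) , Rxy
    walk-++⁻ˡ x (x′ ∷ xs) (Rxx′ ∷ lk , h , l) with walk-++⁻ˡ x′ xs (lk , refl , l)
    ... | v , (lk′ , _ , l′) , Rvy = v , (Rxx′ ∷ lk′ , h , l′) , Rvy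

    walk-++⁻ʳ : ∀ xs {a b y ys} → Walk R a b (xs ++ y ∷ ys) → Walk R y b (y ∷ ys)
    walk-++⁻ʳ [] (lk , refl , l) = lk , refl , l
    walk-++⁻ʳ (_ ∷ []) (_ ∷ lk , _ , l) = lk , refl , l
    walk-++⁻ʳ (_ ∷ x ∷ xs) (_ ∷ lk , _ , l) = walk-++⁻ʳ (x ∷ xs) (lk , refl , l)

    -- Cutting out the closed subwalk between two visits of the same vertex.
    shortcut : DecidableEquality A → ∀ {a b} xs → Walk R a b xs →
               ∃ λ ys → Unique ys × Walk R a b ys × ys ⊆ xs × length ys ≤ length xs
    shortcut _≟_ (x ∷ []) w = x ∷ [] , [] ∷ [] , w , id , ≤-refl
    shortcut _≟_ (x ∷ y ∷ xs) (Rxy ∷ lk , refl , l) with shortcut _≟_ (y ∷ xs) (lk , refl , l)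
    ... | ys , u , w , ys⊆ , len with any? (x ≟_) ys
    ...   | yes x∈ys with ∈-∃++ x∈ys
    ...     | pre , post , refl =
              x ∷ post , unique-++⁻ʳ pre u , walk-++⁻ʳ pre w , there ∘ ys⊆ ∘ ∈-++⁺ʳ pre ,
              m≤n⇒m≤1+n (≤-trans (subst (_ ≤_) (sym (length-++ pre)) (m≤n+m _ _)) len)
    shortcut _≟_ (x ∷ y ∷ xs) (Rxy ∷ lk , refl , l)
      | (.y ∷ ys) , u , (lkys , refl , lys) , ys⊆ , len | no x∉ys =
        x ∷ y ∷ ys , All.tabulate (λ z∈ x≡z → x∉ys (subst (_∈ y ∷ ys) (sym x≡z) z∈)) ∷ u ,
        (Rxy ∷ lkys , refl , lys) , (λ { (here e) → here e ; (there z∈) → there (ys⊆ z∈) }) , s≤s len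

zip-∈ : ∀ {A B : Set} (xs : List A) (ys : List B) {a b} → (a , b) ∈ zip xs ys → a ∈ xs × b ∈ ys
zip-∈ (_ ∷ _) (_ ∷ _) (here refl) = here refl , here refl
zip-∈ (_ ∷ xs) (_ ∷ ys) (there p∈) with zip-∈ xs ys p∈
... | a∈ , b∈ = there a∈ , there b∈

∀-or-∃ : ∀ {m} (P N : Fin m → Set) → (∀ i → P i ⊎ N i) → (∀ i → P i) ⊎ ∃ N
∀-or-∃ {zero} P N f = inj₁ λ ()
∀-or-∃ {suc m} P N f with f zero | ∀-or-∃ (P ∘ suc) (N ∘ suc) (f ∘ suc)
... | inj₂ N₀ | _ = inj₂ (zero , N₀)
... | inj₁ P₀ | inj₁ Pₛ = inj₁ λ { zero → P₀ ; (suc i) → Pₛ i }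
... | inj₁ _  | inj₂ (i , Nᵢ) = inj₂ (suc i , Nᵢ)

module _ {n : ℕ} where

  bounded-search : ∀ k (Q : List (Fin n) → Set) → (∀ xs → Dec (Q xs)) →
                   (∀ xs → length xs ≤ k → Q xs) ⊎ (∃ λ xs → length xs ≤ k × ¬ Q xs)
  bounded-search k Q Q? with Q? []
  ... | no ¬Q[] = inj₂ ([] , z≤n , ¬Q[])
  bounded-search zero Q Q? | yes Q[] = inj₁ λ { [] _ → Q[] ; (_ ∷ _) () }
  bounded-search (suc k) Q Q? | yes Q[]
    with ∀-or-∃ (λ x → ∀ xs → length xs ≤ k → Q (x ∷ xs))
                (λ x → ∃ λ xs → length xs ≤ k × ¬ Q (x ∷ xs))
                (λ x → bounded-search k (Q ∘ (x ∷_)) (Q? ∘ (x ∷_)))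
  ... | inj₁ Q∷ = inj₁ λ { [] _ → Q[] ; (x ∷ xs) (s≤s len) → Q∷ x xs len }
  ... | inj₂ (x , xs , len , ¬Q) = inj₂ (x ∷ xs , s≤s len , ¬Q)

  unique⇒length≤n : ∀ {xs : List (Fin n)} → Unique xs → length xs ≤ n
  unique⇒length≤n {xs} u =
    subst (length xs ≤_) (length-tabulate id) (unique-⊆⇒length-≤ u (λ {z} _ → ∈-allFin z))

  card-exists : (P : Fin n → Set) → (∀ x → Dec (P x)) → ∃ (Card P)
  card-exists P P? =
    length L , L , filter⁺ P? (allFin⁺ n) ,
    (λ x → proj₂ ∘ ∈-filter⁻ P? {xs = allFin n} , ∈-filter⁺ P? (∈-allFin x)) , refl
    where L = filter P? (allFin n)

  card-≤-length : ∀ {P : Fin n → Set} {k xs} → Card P k → (∀ x → P x → x ∈ xs) → k ≤ length xs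
  card-≤-length (L , uL , memL , refl) P⊆xs = unique-⊆⇒length-≤ uL (λ {z} z∈L → P⊆xs z (proj₁ (memL z) z∈L))

  card-mono : ∀ {P Q : Fin n → Set} {k m} → Card P k → Card Q m → (∀ x → P x → Q x) → k ≤ m
  card-mono cardP (M , _ , memM , refl) P⇒Q = card-≤-length cardP (λ x → proj₂ (memM x) ∘ P⇒Q x)

  card-pos : ∀ {P : Fin n → Set} {k x} → Card P k → P x → 1 ≤ k
  card-pos {x = x} (L , _ , memL , refl) Px with proj₂ (memL x) Px
  ... | here _ = s≤s z≤n
  ... | there _ = s≤s z≤n

module _ {n : ℕ} (G : Graph n) where

  adj? : ∀ x y → Dec (Adj G x y)
  adj? x y = Graph.adj G x y Bool.≟ true

  path? : ∀ u v xs → Dec (Path G u v xs)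
  path? u v xs = unique? _≟_ xs ×-dec (linked? adj? xs ×-dec
                   (≡-dec _≟_ (head xs) (just u) ×-dec ≡-dec _≟_ (last xs) (just v)))

  -- Simple paths have at most n vertices, so Covered is decided by a bounded search,
  -- which also produces an escaping path when u is not covered.
  covered-or-escapes : ∀ r (S : Fin n → Set) → (∀ x → Dec (S x)) → ∀ u →
                       Covered G r S u ⊎ (∃ λ xs → Path G u r xs × ¬ Any S xs)
  covered-or-escapes r S S? u
    with bounded-search n (λ xs → Path G u r xs → Any S xs) (λ xs → path? u r xs →-dec any? S? xs)
  ... | inj₁ all = inj₁ λ xs p → all xs (unique⇒length≤n (proj₁ p)) p
  ... | inj₂ (xs , _ , ¬cov) with path? u r xs
  ...   | yes p = inj₂ (xs , p , λ s → ¬cov (λ _ → s))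
  ...   | no ¬p = ⊥-elim (¬cov (⊥-elim ∘ ¬p))

  covered? : ∀ r (S : Fin n → Set) → (∀ x → Dec (S x)) → ∀ u → Dec (Covered G r S u)
  covered? r S S? u with covered-or-escapes r S S? u
  ... | inj₁ cov = yes cov
  ... | inj₂ (xs , p , ¬s) = no λ cov → ¬s (cov xs p)

  -- Only walks with at most d vertices can witness a distance below d.
  distAtLeast? : ∀ (P : Fin n → Set) → (∀ x → Dec (P x)) → ∀ r v d → Dec (DistAtLeast G P r v d)
  distAtLeast? P P? r v d
    with bounded-search d (λ xs → ¬ (WalkIn G P xs × head xs ≡ just r × last xs ≡ just v))
           (λ xs → ¬? ((all? P? xs ×-dec linked? adj? xs) ×-dec
                       (≡-dec _≟_ (head xs) (just r) ×-dec ≡-dec _≟_ (last xs) (just v))))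
  ... | inj₁ noShort = yes long
    where
    long : DistAtLeast G P r v d
    long xs w h l with length xs ≤? d
    ... | yes short = ⊥-elim (noShort xs short (w , h , l))
    long (_ ∷ xs) w h l | no ¬short with ≰⇒> ¬short
    ... | s≤s d≤ = d≤
  ... | inj₂ (_ ∷ _ , short , ¬¬walk) =
        no λ dist → ¬¬walk λ { (w , h , l) → <-irrefl refl (≤-trans short (dist _ w h l)) }
  ... | inj₂ ([] , _ , ¬¬walk) = no λ _ → ¬¬walk λ { (_ , () , _) }

  covers-itself : ∀ {r} {S : Fin n → Set} {v} → S v → Covered G r S v
  covers-itself Sv (_ ∷ _) (_ , _ , refl , _) = here Sv

  walk-avoiding⇒¬Covered : ∀ {r z v} W → Walk (Adj G) z r W → v ∉ W → ¬ Covered G r (_≡ v) z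
  walk-avoiding⇒¬Covered W w v∉W cov with shortcut _≟_ W w
  ... | E , uE , wE , E⊆W , _ = v∉W (E⊆W (Any.map sym (cov E (uE , wE))))

  consecPairs-∈ : ∀ (xs : List (Fin n)) z {v} → v ∈ xs → ∃ λ y → (v , y) ∈ consecPairs G (xs ++ [ z ])
  consecPairs-∈ (_ ∷ []) z (here refl) = z , here refl
  consecPairs-∈ (_ ∷ y ∷ _) z (here refl) = y , here refl
  consecPairs-∈ (_ ∷ x ∷ xs) z (there v∈) with consecPairs-∈ (x ∷ xs) z v∈
  ... | y , p∈ = y , there p∈

  closeCycle-⊆ : ∀ c cs {v} → v ∈ closeCycle G (c ∷ cs) → v ∈ c ∷ cs
  closeCycle-⊆ c cs (here e) = here e
  closeCycle-⊆ c cs (there v∈) with ∈-++⁻ cs v∈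
  ... | inj₁ v∈cs = there v∈cs
  ... | inj₂ (here refl) = here refl

  cycEdge-∈ : ∀ cs {v y} → CycEdge G cs v y → v ∈ cs
  cycEdge-∈ (c ∷ cs) (inj₁ p∈) = closeCycle-⊆ c cs (proj₁ (zip-∈ (c ∷ cs ++ [ c ]) _ p∈))
  cycEdge-∈ (c ∷ cs) (inj₂ p∈) = closeCycle-⊆ c cs (there (proj₂ (zip-∈ (c ∷ cs ++ [ c ]) _ p∈)))

  module _ (r : Fin n) (us : List (Fin n)) where

    Far : Fin n → ℕ → Fin n → Set
    Far u d x = InT G r us u x × DistAtLeast G (InT G r us u) r x d

    inT? : ∀ u x → Dec (InT G r us u x)
    inT? u x = ((x ≟ r) ⊎-dec covered? r (_∈ us) (λ y → any? (y ≟_) us) x)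
               ×-dec ¬? (covered? r (_≡ u) (_≟ u) x)

    countT-exists : ∀ u d → ∃ (CountT G r us u d)
    countT-exists u d = card-exists (Far u d) (λ x → inT? u x ×-dec distAtLeast? (InT G r us u) (inT? u) r x d)

    far-mono : ∀ {u d d′ x} → d ≤ d′ → Far u d′ x → Far u d x
    far-mono d≤d′ (inT , dist) = inT , λ xs w h l → ≤-trans d≤d′ (dist xs w h l)

module _ {n : ℕ} (G : Graph n) (r : Fin n) (us : List (Fin n))
         (one-cycle : AtMostOneCycle G) (C : SimpleCycle G (r ∷ us)) where

  r∉us : r ∉ us
  r∉us = unique-head (proj₁ (proj₂ C))

  -- Both cycles have the same edges, and every vertex of C lies on an edge of C.
  simpleCycle-⊇-C : ∀ D → SimpleCycle G D → (r ∷ us) ⊆ D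
  simpleCycle-⊇-C D D-cycle v∈ with consecPairs-∈ G (r ∷ us) r v∈
  ... | y , p∈ = cycEdge-∈ G D (proj₁ (one-cycle (r ∷ us) D C D-cycle _ y) (inj₁ p∈))

  closed-walk-⊇-C : ∀ {v y} e e′ es → Unique (v ∷ e ∷ e′ ∷ es) → Adj G v e →
                    Walk (Adj G) e y (e ∷ e′ ∷ es) → Adj G y v → (r ∷ us) ⊆ (v ∷ e ∷ e′ ∷ es)
  closed-walk-⊇-C {v} {y} e e′ es u Ave (lk , _ , l) Ayv =
    simpleCycle-⊇-C _ (s≤s (s≤s (s≤s z≤n)) , u , Ave ∷ lk , closing)
    where
    closing : ∀ a b → just v ≡ just a → last (e ∷ e′ ∷ es) ≡ just b → Adj G b a
    closing _ _ refl l′ with trans (sym l) l′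
    ... | refl = Ayv

  -- A path to r avoiding uₕ can meet a neighbour v of r on C only right before r,
  -- since otherwise its part from v to r and the edge rv close a cycle missing uₕ.
  neighbour-on-path⇒penultimate : ∀ {uₕ v x Q} → uₕ ∈ us → v ∈ us → Adj G r v → Path G x r Q →
                                  uₕ ∉ Q → v ∈ Q → ∃ λ pre → Q ≡ pre ++ v ∷ r ∷ []
  neighbour-on-path⇒penultimate {v = v} uₕ∈us v∈us Arv (uQ , wQ) uₕ∉Q v∈Q with ∈-∃++ v∈Q
  ... | pre , [] , refl = ⊥-elim (r∉us (subst (_∈ us) (just-injective (proj₂ (proj₂ (walk-++⁻ʳ pre wQ)))) v∈us))
  ... | pre , c ∷ [] , refl with just-injective (proj₂ (proj₂ (walk-++⁻ʳ pre wQ)))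
  ...   | refl = pre , refl
  neighbour-on-path⇒penultimate {v = v} uₕ∈us v∈us Arv (uQ , wQ) uₕ∉Q v∈Q | pre , c ∷ c′ ∷ post , refl
    with walk-uncons (walk-++⁻ʳ pre wQ)
  ... | Avc , wc =
        ⊥-elim (uₕ∉Q (∈-++⁺ʳ pre (closed-walk-⊇-C c c′ post (unique-++⁻ʳ pre uQ) Avc wc Arv (there uₕ∈us))))

  module _ {u₁ uₚ} (hd : head us ≡ just u₁) (lt : last us ≡ just uₚ) where

    r-adj-u₁ : Adj G r u₁
    r-adj-u₁ = linked-∷-head us (proj₁ (proj₂ (proj₂ C))) hd

    r-adj-uₚ : Adj G r uₚ
    r-adj-uₚ = trans (Graph.sym G r uₚ) (proj₂ (proj₂ (proj₂ C)) r uₚ refl (last-∷ r us lt))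

    u₁≢uₚ : u₁ ≢ uₚ
    u₁≢uₚ with proj₁ C | proj₁ (proj₂ C)
    ... | s≤s 2≤ | _ ∷ uus = unique-head≢last uus 2≤ hd lt

    one-end-avoided : ∀ {uₕ x Q} → uₕ ∈ us → Path G x r Q → uₕ ∉ Q → u₁ ∉ Q ⊎ uₚ ∉ Q
    one-end-avoided {Q = Q} uₕ∈us Q-path uₕ∉Q with any? (u₁ ≟_) Q | any? (uₚ ≟_) Q
    ... | no u₁∉Q | _ = inj₁ u₁∉Q
    ... | yes _ | no uₚ∉Q = inj₂ uₚ∉Q
    ... | yes u₁∈Q | yes uₚ∈Q
      with neighbour-on-path⇒penultimate uₕ∈us (head-∈ hd) r-adj-u₁ Q-path uₕ∉Q u₁∈Q
         | neighbour-on-path⇒penultimate uₕ∈us (last-∈ lt) r-adj-uₚ Q-path uₕ∉Q uₚ∈Q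
    ... | pre₁ , eq₁ | preₚ , eqₚ = ⊥-elim (u₁≢uₚ (penultimate-injective pre₁ preₚ (trans (sym eq₁) eqₚ)))

  module Reroute {uₕ b x : Fin n} {Qt : List (Fin n)} (uₕ∈us : uₕ ∈ us) (b∈us : b ∈ us)
                 (Q-path : Path G x r (x ∷ Qt)) (uₕ∉Q : uₕ ∉ x ∷ Qt) (b∉Q : b ∉ x ∷ Qt) where

    b∉T∖b : ∀ {P} → All (InT G r us b) P → b ∉ P
    b∉T∖b inT b∈P = proj₂ (All.lookup inT b∈P) (covers-itself G refl)

    uₕ∉detour : ∀ pre p₁ post → Unique (r ∷ pre ++ uₕ ∷ p₁ ∷ post) → uₕ ∉ (p₁ ∷ post ++ Qt) ++ pre
    uₕ∉detour pre p₁ post uP =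
      [ unique-head (unique-++⁻ʳ (r ∷ pre) uP)
      , [ uₕ∉Q ∘ there , (λ uₕ∈pre → unique-++-disjoint (r ∷ pre) uP (there uₕ∈pre) (here refl) refl) ]′ ]′
      ∘ ∈-++-++⁻ (p₁ ∷ post) Qt

    b∉detour : ∀ pre p₁ post → All (InT G r us b) (r ∷ pre ++ uₕ ∷ p₁ ∷ post) → b ∉ (p₁ ∷ post ++ Qt) ++ pre
    b∉detour pre p₁ post inT =
      [ b∉T∖b inT ∘ ∈-++⁺ʳ (r ∷ pre) ∘ there , [ b∉Q ∘ there , b∉T∖b inT ∘ there ∘ ∈-++⁺ˡ ]′ ]′
      ∘ ∈-++-++⁻ (p₁ ∷ post) Qt

    -- p₁ ⋯ x, then Q, then r ⋯ y is a walk from p₁ to y missing uₕ and b; shortened to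
    -- a path it closes up with y uₕ p₁ to a cycle missing b.
    no-detour-through-uₕ : ∀ pre p₁ post → Path G r x (r ∷ pre ++ uₕ ∷ p₁ ∷ post) →
                           All (InT G r us b) (r ∷ pre ++ uₕ ∷ p₁ ∷ post) → ⊥
    no-detour-through-uₕ pre p₁ post (uP , wP) inT
      with walk-++⁻ˡ r pre wP | walk-uncons (walk-++⁻ʳ (r ∷ pre) wP)
    ... | y , wPre , Ayuₕ | Auₕp₁ , wPost
      with shortcut _≟_ ((p₁ ∷ post ++ Qt) ++ pre)
             (walk-++ (p₁ ∷ post ++ Qt) pre (walk-++ (p₁ ∷ post) Qt wPost (proj₂ Q-path)) wPre)
    ... | _ ∷ [] , _ , (_ , refl , refl) , _ , _ =
          unique-++-disjoint (r ∷ pre) uP (last-∈ (proj₂ (proj₂ wPre))) (there (here refl)) refl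
    ... | _ ∷ e′ ∷ es , uE , wE@(_ , refl , _) , E⊆W , _
      with closed-walk-⊇-C p₁ e′ es (uₕ∉E ∷ uE) Auₕp₁ wE Ayuₕ (there b∈us)
      where
      uₕ∉E : All (uₕ ≢_) (p₁ ∷ e′ ∷ es)
      uₕ∉E = All.tabulate λ e∈ uₕ≡e → uₕ∉detour pre p₁ post uP (E⊆W (subst (_∈ _) (sym uₕ≡e) e∈))
    ... | here b≡uₕ = b∉T∖b inT (∈-++⁺ʳ (r ∷ pre) (here b≡uₕ))
    ... | there b∈E = b∉detour pre p₁ post inT (E⊆W b∈E)

    uₕ∉path-in-T∖b : ∀ {P} → Path G r x P → All (InT G r us b) P → uₕ ∉ P
    uₕ∉path-in-T∖b {P} P-path inT uₕ∈P with ∈-∃++ uₕ∈P | P-path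
    ... | [] , _ , refl | _ , _ , h , _ = r∉us (subst (_∈ us) (just-injective h) uₕ∈us)
    ... | pre , [] , refl | _ = uₕ∉Q (here (just-injective (proj₂ (proj₂ (walk-++⁻ʳ pre (proj₂ P-path))))))
    ... | _ ∷ pre , p₁ ∷ post , refl | _ , _ , refl , _ = no-detour-through-uₕ pre p₁ post P-path inT

    ¬Covered-along : ∀ {a P z} → Walk (Adj G) a x P → uₕ ∉ P → z ∈ P → ¬ Covered G r (_≡ uₕ) z
    ¬Covered-along {z = z} wP uₕ∉P z∈P with ∈-∃++ z∈P
    ... | pre , post , refl =
          walk-avoiding⇒¬Covered G ((z ∷ post) ++ Qt)
            (walk-++ (z ∷ post) Qt (walk-++⁻ʳ pre wP) (proj₂ Q-path))
            ([ uₕ∉P ∘ ∈-++⁺ʳ pre , uₕ∉Q ∘ there ]′ ∘ ∈-++⁻ (z ∷ post))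

    path-in-T∖b⊆T∖uₕ : ∀ {P} → Path G r x P → All (InT G r us b) P → All (InT G r us uₕ) P
    path-in-T∖b⊆T∖uₕ P-path inT = All.tabulate λ z∈P →
      proj₁ (All.lookup inT z∈P) , ¬Covered-along (proj₂ P-path) (uₕ∉path-in-T∖b P-path inT) z∈P

    far-in-T∖b : ∀ {d} → Far G r us uₕ d x → Far G r us b d x
    far-in-T∖b ((x∈rκC , _) , dist) = (x∈rκC , walk-avoiding⇒¬Covered G (x ∷ Qt) (proj₂ Q-path) b∉Q) , dist′
      where
      dist′ : DistAtLeast G (InT G r us b) r x _
      dist′ xs (inT , lk) h l with shortcut _≟_ xs (lk , h , l)
      ... | P , uP , wP , P⊆xs , len =
            ≤-trans (dist P (path-in-T∖b⊆T∖uₕ (uP , wP) (All.tabulate (All.lookup inT ∘ P⊆xs)) , proj₁ wP)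
                             (proj₁ (proj₂ wP)) (proj₂ (proj₂ wP)))
                    (∸-monoˡ-≤ 1 len)

  far-in-T∖uₕ⇒far-at-an-end : ∀ {u₁ uₚ uₕ d x} → head us ≡ just u₁ → last us ≡ just uₚ → uₕ ∈ us →
                              Far G r us uₕ d x → Far G r us u₁ d x ⊎ Far G r us uₚ d x
  far-in-T∖uₕ⇒far-at-an-end {uₕ = uₕ} {x = x} hd lt uₕ∈us far with covered-or-escapes G r (_≡ uₕ) (_≟ uₕ) x
  ... | inj₁ cov = ⊥-elim (proj₂ (proj₁ far) cov)
  ... | inj₂ ([] , (_ , _ , () , _) , _)
  ... | inj₂ (_ ∷ Qt , Q-path@(_ , _ , refl , _) , ¬any)
    with one-end-avoided hd lt uₕ∈us Q-path (¬any ∘ Any.map sym)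
  ... | inj₁ u₁∉Q = inj₁ (Reroute.far-in-T∖b uₕ∈us (head-∈ hd) Q-path (¬any ∘ Any.map sym) u₁∉Q far)
  ... | inj₂ uₚ∉Q = inj₂ (Reroute.far-in-T∖b uₕ∈us (last-∈ lt) Q-path (¬any ∘ Any.map sym) uₚ∉Q far)

  count-≤-sum-at-ends : ∀ {u₁ uₚ uₕ d a c₁ cₚ} → head us ≡ just u₁ → last us ≡ just uₚ → uₕ ∈ us →
                        CountT G r us u₁ d c₁ → CountT G r us uₚ d cₚ → CountT G r us uₕ d a → a ≤ c₁ + cₚ
  count-≤-sum-at-ends hd lt uₕ∈us (L₁ , _ , mem₁ , refl) (Lₚ , _ , memₚ , refl) countₕ =
    subst (_ ≤_) (length-++ L₁)
      (card-≤-length countₕ λ x far →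
        [ ∈-++⁺ˡ ∘ proj₂ (mem₁ x) , ∈-++⁺ʳ L₁ ∘ proj₂ (memₚ x) ]′ (far-in-T∖uₕ⇒far-at-an-end hd lt uₕ∈us far))

module _ {n : ℕ} (G : Graph n) (r : Fin n) (us : List (Fin n)) where

  count-≤-1+w : ∀ {u d a W} → Card (Covered G r (_∈ us)) W → CountT G r us u d a → a ≤ suc W
  count-≤-1+w (Wl , _ , memW , refl) countₕ =
    card-≤-length countₕ λ x far → [ (λ { refl → here refl }) , there ∘ proj₂ (memW x) ]′ (proj₁ (proj₁ far))

  within-tolerance : ∀ {u W t d b} → IsTol G r us u W t → d ≤ t → CountT G r us u d b → W ≤ b * b
  within-tolerance ((c , count-t , W≤c²) , _) d≤t count-d =
    ≤-trans W≤c² (*-mono-≤ c≤b c≤b)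
    where c≤b = card-mono count-t count-d (λ _ → far-mono G r us d≤t)

  beyond-tolerance : ∀ {u W t d c} → IsTol G r us u W t → t < d → CountT G r us u d c → c * c < W
  beyond-tolerance {W = W} {c = c} (_ , maximal) t<d count with W ≤? c * c
  ... | yes W≤c² = ⊥-elim (<-irrefl refl (≤-<-trans (maximal _ c count W≤c²) t<d))
  ... | no W≰c² = ≰⇒> W≰c²

double-square : ∀ m → (m + m) * (m + m) ≡ 4 * m * m
double-square = solve 1 (λ m → (m :+ m) :* (m :+ m) := con 4 :* m :* m) refl
  where open +-*-Solver

square-≤-of-≤-1+W : ∀ {a W b} → a ≤ suc W → 1 ≤ W → W ≤ b * b → a * a ≤ 4 * W * (suc b * suc b)
square-≤-of-≤-1+W {a} {W} {b} a≤1+W 1≤W W≤b² = begin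
  a * a                   ≤⟨ *-mono-≤ a≤2W a≤2W ⟩
  (W + W) * (W + W)       ≡⟨ double-square W ⟩
  4 * W * W               ≤⟨ *-monoʳ-≤ (4 * W) (≤-trans W≤b² (*-mono-≤ (n≤1+n b) (n≤1+n b))) ⟩
  4 * W * (suc b * suc b) ∎
  where
  open ≤-Reasoning
  a≤2W : a ≤ W + W
  a≤2W = ≤-trans a≤1+W (+-monoˡ-≤ W 1≤W)

square-≤-of-≤-sum : ∀ {a c₁ c₂ W b} → a ≤ c₁ + c₂ → c₁ * c₁ < W → c₂ * c₂ < W → a * a ≤ 4 * W * (suc b * suc b)
square-≤-of-≤-sum {a} {c₁} {c₂} {W} {b} a≤c₁+c₂ c₁²<W c₂²<W = begin
  a * a                   ≤⟨ *-mono-≤ a≤2m a≤2m ⟩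
  (m + m) * (m + m)       ≡⟨ double-square m ⟩
  4 * m * m               ≡⟨ *-assoc 4 m m ⟩
  4 * (m * m)             ≤⟨ *-monoʳ-≤ 4 (<⇒≤ m²<W) ⟩
  4 * W                   ≡⟨ sym (*-identityʳ (4 * W)) ⟩
  4 * W * 1               ≤⟨ *-monoʳ-≤ (4 * W) (s≤s z≤n) ⟩
  4 * W * (suc b * suc b) ∎
  where
  open ≤-Reasoning
  m = c₁ ⊔ c₂
  a≤2m : a ≤ m + m
  a≤2m = ≤-trans a≤c₁+c₂ (+-mono-≤ (m≤m⊔n c₁ c₂) (m≤n⊔m c₁ c₂))
  m²<W : m * m < W
  m²<W with ⊔-sel c₁ c₂
  ... | inj₁ m≡c₁ rewrite m≡c₁ = c₁²<W
  ... | inj₂ m≡c₂ rewrite m≡c₂ = c₂²<W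

lemma5 : ∀ {n} (G : Graph n) (r : Fin n) (us : List (Fin n)) →
    AlmostTree1 G →
    SimpleCycle G (r ∷ us) →
    ∀ (u₁ uₚ : Fin n) → head us ≡ just u₁ → last us ≡ just uₚ →
    ∀ (W : ℕ) → Card (Covered G r (_∈ us)) W →
    (∀ v → (Adj G r v ⊎ v ∈ us) → ∀ k → Card (Covered G r (_≡ v)) k → k * k < W) →
    ∀ (û : Fin n) → (û ≡ u₁ ⊎ û ≡ uₚ) →
    (∃ λ t₁ → ∃ λ tₚ → ∃ λ t̂ → IsTol G r us u₁ W t₁ × IsTol G r us uₚ W tₚ
                              × IsTol G r us û W t̂ × t̂ ≡ t₁ ⊔ tₚ) →
    ∀ (uₕ : Fin n) → uₕ ∈ us → ∀ (d a b : ℕ) →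
    CountT G r us uₕ d a → CountT G r us û d b →
    a * a ≤ 4 * W * (suc b * suc b)
lemma5 G r us (_ , one-cycle) C u₁ uₚ hd lt W cardW _ û _
       (t₁ , tₚ , t̂ , tol₁ , tolₚ , tolû , t̂≡t₁⊔tₚ) uₕ uₕ∈us d a b countₕ countû
  with d ≤? t̂ | countT-exists G r us u₁ d | countT-exists G r us uₚ d
... | yes d≤t̂ | _ | _ =
      square-≤-of-≤-1+W {b = b} (count-≤-1+w G r us cardW countₕ) (card-pos cardW (covers-itself G uₕ∈us))
        (within-tolerance G r us tolû d≤t̂ countû)
... | no d≰t̂ | c₁ , count₁ | cₚ , countₚ =
      square-≤-of-≤-sum {c₁ = c₁} {c₂ = cₚ} {b = b} (count-≤-sum-at-ends G r us one-cycle C hd lt uₕ∈us count₁ countₚ countₕ)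
        (beyond-tolerance G r us tol₁ (t<d (m≤m⊔n t₁ tₚ)) count₁)
        (beyond-tolerance G r us tolₚ (t<d (m≤n⊔m t₁ tₚ)) countₚ)
    where
    t<d : ∀ {t} → t ≤ t₁ ⊔ tₚ → t < d
    t<d t≤ = ≤-<-trans (subst (_ ≤_) (sym t̂≡t₁⊔tₚ) t≤) (≰⇒> d≰t̂)
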